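{- If $p$ and $p'$ are $\mathrm{BPA}^*_{01}$ expressions such that $p\to^+ p'$, then $\mathrm{OC}(p)\ge \mathrm{OC}(p')$. Moreover, if $\mathrm{OC}(p)=\mathrm{OC}(p')$, then $p=p_1\cdot q$ and $p'=p_1'\cdot q$ for some expressions $p_1$, $p_1'$ and $q$.
   Context: Fix a non-empty set $A$ of actions. $\mathrm{BPA}^*_{01}$ expressions are generated by $p ::= \mathbf{0} \mid \mathbf{1} \mid a \mid p\cdot p \mid p+p \mid p^*$ with $a\in A$ (equality is syntactic identity). The transition relation $p\xrightarrow{a}p'$ and termination predicate $p\downarrow$ are the least relations such that: $\mathbf{1}\downarrow$; $a\xrightarrow{a}\mathbf{1}$; if $p\xrightarrow{a}p'$ then $p+q\xrightarrow{a}p'$ and $q+p\xrightarrow{a}p'$; if $p\downarrow$ then $(p+q)\downarrow$ and $(q+p)\downarrow$; if $p\xrightarrow{a}p'$ then $p\cdot q\xrightarrow{a}p'\cdot q$; if $p\downarrow$ and $q\xrightarrow{a}q'$ then $p\cdot q\xrightarrow{a}q'$; if $p\downarrow$ and $q\downarrow$ then $(p\cdot q)\downarrow$; if $p\xrightarrow{a}p'$ then $p^*\xrightarrow{a}p'\cdot p^*$; $p^*\downarrow$. $p\to q$ means $p\xrightarrow{a}q$ for some $a$, and $\to^+$ is its transitive closure. The measure $\mathrm{OC}$ is defined by structural recursion: $\mathrm{OC}(\mathbf{0})=\mathrm{OC}(\mathbf{1})=0$, $\mathrm{OC}(a)=1$; $\mathrm{OC}(p\cdot q)=0$ if $q$ is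 a star expression (of the form $r^*$) and $\mathrm{OC}(p\cdot q)=\mathrm{OC}(q)+1$ otherwise; $\mathrm{OC}(p+q)=\max(\mathrm{OC}(p),\mathrm{OC}(q))+1$; $\mathrm{OC}(p^*)=1$. -}

module Defs where

open import Data.Nat using (ℕ; zero; suc; _⊔_)
open import Relation.Binary.Construct.Closure.Transitive using (TransClosure)

data Exp (A : Set) : Set where
  𝟘 𝟙 : Exp A
  act : A → Exp A
  _·_ : Exp A → Exp A → Exp A
  _+_ : Exp A → Exp A → Exp A
  _* : Exp A → Exp A

infixl 7 _·_
infixl 6 _+_
infix 8 _*

module _ {A : Set} where

  data _↓ : Exp A → Set where
    𝟙↓  : 𝟙 ↓
    +ˡ↓ : ∀ {p q} → p ↓ → (p + q) ↓
    +ʳ↓ : ∀ {p q} → q ↓ → (p + q) ↓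
    ·↓  : ∀ {p q} → p ↓ → q ↓ → (p · q) ↓
    *↓  : ∀ {p} → (p *) ↓

  data _─⟨_⟩→_ : Exp A → A → Exp A → Set where
    act→ : ∀ {a} → act a ─⟨ a ⟩→ 𝟙
    +ˡ→  : ∀ {p q a p'} → p ─⟨ a ⟩→ p' → (p + q) ─⟨ a ⟩→ p'
    +ʳ→  : ∀ {p q a p'} → p ─⟨ a ⟩→ p' → (q + p) ─⟨ a ⟩→ p'
    ·ˡ→  : ∀ {p q a p'} → p ─⟨ a ⟩→ p' → (p · q) ─⟨ a ⟩→ (p' · q)
    ·ʳ→  : ∀ {p q a q'} → p ↓ → q ─⟨ a ⟩→ q' → (p · q) ─⟨ a ⟩→ q'
    *→   : ∀ {p a p'} → p ─⟨ a ⟩→ p' → (p *) ─⟨ a ⟩→ (p' · (p *))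

  data _⟶_ (p q : Exp A) : Set where
    step : (a : A) → p ─⟨ a ⟩→ q → p ⟶ q

  _⟶⁺_ : Exp A → Exp A → Set
  _⟶⁺_ = TransClosure _⟶_

  OC : Exp A → ℕ
  OC 𝟘 = 0
  OC 𝟙 = 0
  OC (act a) = 1
  OC (p · (q *)) = 0
  OC (p · q) = suc (OC q)
  OC (p + q) = suc (OC p ⊔ OC q)
  OC (p *) = 1

-- A single transition either happens inside the left factor of a product,
-- which changes neither the right factor nor OC (OC of p · q only depends
-- on q), or lowers OC strictly; the one exception, a terminated p in p · r*
-- handing over to r*, yields r' · r*, where both sides have OC 0 and share
-- the right factor r*. Both alternatives compose along a path because the
-- right factor of a product is determined by the product.
module Submission where

open import Defs
open import Data.Nat using (_≥_; _≤_; _<_; s≤s; z≤n)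
open import Data.Nat.Properties using (≤-trans; ≤-reflexive; <-trans; <-≤-trans; ≤-<-trans; <⇒≤; <⇒≢; m≤m⊔n; m≤n⊔m)
open import Data.Product using (∃; _×_; _,_)
open import Relation.Binary.PropositionalEquality using (_≡_; refl; sym; trans)
open import Data.Empty using (⊥-elim)
open import Relation.Binary.Construct.Closure.Transitive using ([_]; _∷_)

module _ {A : Set} where

  SharedRightFactor : Exp A → Exp A → Set
  SharedRightFactor p p' = ∃ λ p₁ → ∃ λ p₁' → ∃ λ q → (p ≡ p₁ · q) × (p' ≡ p₁' · q)

  SharedRightFactor-trans : ∀ {p m p'} →
    SharedRightFactor p m → SharedRightFactor m p' → SharedRightFactor p p'
  SharedRightFactor-trans (p₁ , _ , q , refl , refl) (_ , p₁' , _ , refl , refl) =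
    p₁ , p₁' , q , refl , refl

  data OCDescent (p p' : Exp A) : Set where
    strict : OC p' < OC p → OCDescent p p'
    level  : OC p' ≡ OC p → SharedRightFactor p p' → OCDescent p p'

  OCDescent⇒≤ : ∀ {p p'} → OCDescent p p' → OC p' ≤ OC p
  OCDescent⇒≤ (strict lt)  = <⇒≤ lt
  OCDescent⇒≤ (level eq _) = ≤-reflexive eq

  OCDescent-trans : ∀ {p m p'} → OCDescent p m → OCDescent m p' → OCDescent p p'
  OCDescent-trans (strict lt)  (strict lt') = strict (<-trans lt' lt)
  OCDescent-trans (strict lt)  (level eq _) = strict (≤-<-trans (≤-reflexive eq) lt)
  OCDescent-trans (level eq _) (strict lt)  = strict (<-≤-trans lt (≤-reflexive eq))
  OCDescent-trans (level eq s) (level eq' s') =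
    level (trans eq' eq) (SharedRightFactor-trans s s')

  OC-·-left-irrelevant : ∀ (p p' q : Exp A) → OC (p · q) ≡ OC (p' · q)
  OC-·-left-irrelevant p p' 𝟘       = refl
  OC-·-left-irrelevant p p' 𝟙       = refl
  OC-·-left-irrelevant p p' (act _) = refl
  OC-·-left-irrelevant p p' (_ · _) = refl
  OC-·-left-irrelevant p p' (_ + _) = refl
  OC-·-left-irrelevant p p' (_ *)   = refl

  ─→-OCDescent : ∀ {p a p'} → p ─⟨ a ⟩→ p' → OCDescent p p'
  ─→-OCDescent act→ = strict (s≤s z≤n)
  ─→-OCDescent (+ˡ→ {p} {q} t) =
    strict (s≤s (≤-trans (OCDescent⇒≤ (─→-OCDescent t)) (m≤m⊔n (OC p) (OC q))))
  ─→-OCDescent (+ʳ→ {p} {q} t) =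
    strict (s≤s (≤-trans (OCDescent⇒≤ (─→-OCDescent t)) (m≤n⊔m (OC q) (OC p))))
  ─→-OCDescent (·ˡ→ {p} {q} {p' = p'} t) =
    level (OC-·-left-irrelevant p' p q) (p , p' , q , refl , refl)
  ─→-OCDescent (·ʳ→ {q = act _} _ t) = strict (s≤s (OCDescent⇒≤ (─→-OCDescent t)))
  ─→-OCDescent (·ʳ→ {q = _ · _} _ t) = strict (s≤s (OCDescent⇒≤ (─→-OCDescent t)))
  ─→-OCDescent (·ʳ→ {q = _ + _} _ t) = strict (s≤s (OCDescent⇒≤ (─→-OCDescent t)))
  ─→-OCDescent (·ʳ→ {p} {q = r *} _ (*→ {p' = r'} _)) =
    level refl (p , r' , r * , refl , refl)
  ─→-OCDescent (*→ _) = strict (s≤s z≤n)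

  ⟶⁺-OCDescent : ∀ {p p'} → p ⟶⁺ p' → OCDescent p p'
  ⟶⁺-OCDescent [ step _ t ]         = ─→-OCDescent t
  ⟶⁺-OCDescent (step _ t ∷ m⟶⁺p') = OCDescent-trans (─→-OCDescent t) (⟶⁺-OCDescent m⟶⁺p')

  lemma8 : A → (p p' : Exp A) → p ⟶⁺ p' →
    (OC p ≥ OC p') ×
    (OC p ≡ OC p' → ∃ λ p₁ → ∃ λ p₁' → ∃ λ q → (p ≡ p₁ · q) × (p' ≡ p₁' · q))
  lemma8 _ p p' p⟶⁺p' with ⟶⁺-OCDescent p⟶⁺p'
  ... | strict lt       = <⇒≤ lt , λ eq → ⊥-elim (<⇒≢ lt (sym eq))
  ... | level eq shared = ≤-reflexive eq , λ _ → shared
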